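{- Let $u,v,y$ be words and $x$ a letter such that the concatenation $uxvy$ is a permutation (all letters distinct). Then $\mathrm{iDes}(uxvy)=\mathrm{iDes}(ux\beta_x(v)y)$.
   Context: For a permutation $w$, $\mathrm{iDes}(w)$ is the set of $i$ such that $i+1$ lies to the left of $i$ in $w$. For a word $w=w_1\cdots w_m$ with distinct letters and a letter $x$ not in $w$, define the index set $B_x$ recursively: if the value $x$ lies between $w_1$ and $w_2$, then $1\in B_x$; if $i\in B_x$ and exactly one of $w_i,w_{i+1}$ has value between $w_{i+2}$ and $w_{i+3}$, then $i+2\in B_x$. Then $\beta_x(w)$ is obtained by swapping $w_i$ and $w_{i+1}$ for every $i\in B_x$. (Example: $B_5(83691724)=\{1,3,5\}$ and $\beta_5(83691724)=38967124$.) -}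

module Defs where

open import Data.Nat using (ℕ; suc; _<ᵇ_)
open import Data.Bool using (Bool; true; false; if_then_else_; _∧_; _∨_; _xor_)
open import Data.List using (List; []; _∷_; _++_; map; upTo; length)
open import Data.List.Relation.Binary.Permutation.Propositional using (_↭_)
open import Data.Product using (∃; ∃-syntax; _×_)
open import Relation.Binary.PropositionalEquality using (_≡_; refl)

Word : Set
Word = List ℕ

IsPermutation : Word → Set
IsPermutation w = w ↭ map suc (upTo (length w))

LeftOf : ℕ → ℕ → Word → Set
LeftOf a b w = ∃[ w₁ ] ∃[ w₂ ] ∃[ w₃ ] (w ≡ w₁ ++ a ∷ w₂ ++ b ∷ w₃)

_∈iDes_ : ℕ → Word → Set
i ∈iDes w = LeftOf (suc i) i w

between : ℕ → ℕ → ℕ → Bool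
between a b c = ((a <ᵇ b) ∧ (b <ᵇ c)) ∨ ((c <ᵇ b) ∧ (b <ᵇ a))

-- Continuation of the recursion defining B_x: given the (original) pair
-- (a , b) = (w_i , w_{i+1}) with i ∈ B_x, and the remaining word
-- w_{i+2} w_{i+3} ..., decide whether i+2 ∈ B_x, swapping accordingly.
βgo : ℕ → ℕ → Word → Word
βgo a b (c ∷ d ∷ rest) =
  if between c a d xor between c b d
  then d ∷ c ∷ βgo c d rest
  else c ∷ d ∷ rest
βgo a b rest = rest

-- β_x(w): swap w_i and w_{i+1} for every i ∈ B_x.
β : ℕ → Word → Word
β x (a ∷ b ∷ rest) =
  if between a x b then b ∷ a ∷ βgo a b rest else a ∷ b ∷ rest
β x w = w

-- sanity check against the example in the paper
private
  example : β 5 (8 ∷ 3 ∷ 6 ∷ 9 ∷ 1 ∷ 7 ∷ 2 ∷ 4 ∷ []) ≡ 3 ∷ 8 ∷ 9 ∷ 6 ∷ 7 ∷ 1 ∷ 2 ∷ 4 ∷ []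
  example = refl

module Submission where

-- Every swap performed by β exchanges two adjacent letters with some value
-- strictly between them, hence two letters with non-consecutive values, and
-- such a swap never changes the relative order of i + 1 and i.

open import Defs
open import Data.Nat using (ℕ; zero; suc; _<ᵇ_)
open import Data.Bool using (true; false; _∧_; _xor_)
open import Data.Bool.Properties using (∨-comm)
open import Data.List using (List; []; _∷_; _++_)
open import Data.List.Membership.Propositional using (_∈_)
open import Data.List.Membership.Propositional.Properties using (∈-∃++; ∈-++⁺ʳ)
open import Data.List.Relation.Unary.Any using (here; there)
open import Data.Product using (_×_; _,_) renaming (swap to ×-swap)
open import Data.Sum using (_⊎_; inj₁; inj₂; [_,_])
open import Relation.Binary.PropositionalEquality using (_≡_; refl; _≢_; sym; trans)
open import Function.Bundles using (_⇔_; mk⇔)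

NonConsecutive : ℕ → ℕ → Set
NonConsecutive a b = a ≢ suc b × b ≢ suc a

between-sym : ∀ a z b → between a z b ≡ between b z a
between-sym a z b = ∨-comm ((a <ᵇ z) ∧ (z <ᵇ b)) ((b <ᵇ z) ∧ (z <ᵇ a))

between-suc : ∀ c z → between c z (suc c) ≡ false
between-suc zero    zero          = refl
between-suc zero    (suc zero)    = refl
between-suc zero    (suc (suc z)) = refl
between-suc (suc c) zero          = refl
between-suc (suc c) (suc z)       = between-suc c z

between⇒nonConsecutive : ∀ a z b → between a z b ≡ true → NonConsecutive a b
between⇒nonConsecutive a z b btw = sucˡ , sucʳ
  where
  sucˡ : a ≢ suc b
  sucˡ refl with () ← trans (sym btw) (trans (between-sym (suc b) z b) (between-suc b z))
  sucʳ : b ≢ suc a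
  sucʳ refl with () ← trans (sym btw) (between-suc a z)

xor≡true⇒⊎ : ∀ x y → x xor y ≡ true → x ≡ true ⊎ y ≡ true
xor≡true⇒⊎ true  y eq = inj₁ refl
xor≡true⇒⊎ false y eq = inj₂ eq

data NonConsecutiveSwaps : List ℕ → List ℕ → Set where
  []   : NonConsecutiveSwaps [] []
  keep : ∀ {a w w′} → NonConsecutiveSwaps w w′ →
         NonConsecutiveSwaps (a ∷ w) (a ∷ w′)
  swap : ∀ {a b w w′} → NonConsecutive a b → NonConsecutiveSwaps w w′ →
         NonConsecutiveSwaps (a ∷ b ∷ w) (b ∷ a ∷ w′)

swaps-refl : ∀ w → NonConsecutiveSwaps w w
swaps-refl []      = []
swaps-refl (a ∷ w) = keep (swaps-refl w)

swaps-sym : ∀ {w w′} → NonConsecutiveSwaps w w′ → NonConsecutiveSwaps w′ w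
swaps-sym []         = []
swaps-sym (keep s)   = keep (swaps-sym s)
swaps-sym (swap n s) = swap (×-swap n) (swaps-sym s)

swaps-++ˡ : ∀ u {w w′} → NonConsecutiveSwaps w w′ →
            NonConsecutiveSwaps (u ++ w) (u ++ w′)
swaps-++ˡ []      s = s
swaps-++ˡ (a ∷ u) s = keep (swaps-++ˡ u s)

swaps-++ʳ : ∀ y {w w′} → NonConsecutiveSwaps w w′ →
            NonConsecutiveSwaps (w ++ y) (w′ ++ y)
swaps-++ʳ y []         = swaps-refl y
swaps-++ʳ y (keep s)   = keep (swaps-++ʳ y s)
swaps-++ʳ y (swap n s) = swap n (swaps-++ʳ y s)

swaps-∈ : ∀ {w w′ z} → NonConsecutiveSwaps w w′ → z ∈ w → z ∈ w′
swaps-∈ (keep s)   (here e)          = here e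
swaps-∈ (keep s)   (there m)         = there (swaps-∈ s m)
swaps-∈ (swap n s) (here e)          = there (here e)
swaps-∈ (swap n s) (there (here e))  = here e
swaps-∈ (swap n s) (there (there m)) = there (there (swaps-∈ s m))

data Precedes (p q : ℕ) : List ℕ → Set where
  here  : ∀ {w} → q ∈ w → Precedes p q (p ∷ w)
  there : ∀ {a w} → Precedes p q w → Precedes p q (a ∷ w)

LeftOf⇒Precedes : ∀ {p q} w → LeftOf p q w → Precedes p q w
LeftOf⇒Precedes _ ([]       , w₂ , w₃ , refl) = here (∈-++⁺ʳ w₂ (here refl))
LeftOf⇒Precedes _ ((a ∷ w₁) , w₂ , w₃ , refl) = there (LeftOf⇒Precedes _ (w₁ , w₂ , w₃ , refl))

Precedes⇒LeftOf : ∀ {p q} w → Precedes p q w → LeftOf p q w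
Precedes⇒LeftOf (p ∷ w) (here m) with ∈-∃++ m
... | w₂ , w₃ , refl = [] , w₂ , w₃ , refl
Precedes⇒LeftOf (a ∷ w) (there l) with Precedes⇒LeftOf w l
... | w₁ , w₂ , w₃ , refl = (a ∷ w₁) , w₂ , w₃ , refl

swaps-preserve-Precedes : ∀ {i w w′} → NonConsecutiveSwaps w w′ →
                          Precedes (suc i) i w → Precedes (suc i) i w′
swaps-preserve-Precedes (keep s)         (here m)          = here (swaps-∈ s m)
swaps-preserve-Precedes (keep s)         (there l)         = there (swaps-preserve-Precedes s l)
swaps-preserve-Precedes (swap (n , _) s) (here (here refl)) with () ← n refl
swaps-preserve-Precedes (swap n s)       (here (there m))  = there (here (swaps-∈ s m))
swaps-preserve-Precedes (swap n s)       (there (here m))  = here (there (swaps-∈ s m))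
swaps-preserve-Precedes (swap n s)       (there (there l)) = there (there (swaps-preserve-Precedes s l))

swaps-preserve-iDes : ∀ {i w w′} → NonConsecutiveSwaps w w′ → i ∈iDes w → i ∈iDes w′
swaps-preserve-iDes {w = w} {w′} s d =
  Precedes⇒LeftOf w′ (swaps-preserve-Precedes s (LeftOf⇒Precedes w d))

βgo-swaps : ∀ a b w → NonConsecutiveSwaps w (βgo a b w)
βgo-swaps a b []       = []
βgo-swaps a b (c ∷ []) = keep []
βgo-swaps a b (c ∷ d ∷ rest) with between c a d xor between c b d in eq
... | true  = swap ([ between⇒nonConsecutive c a d , between⇒nonConsecutive c b d ]
                      (xor≡true⇒⊎ (between c a d) (between c b d) eq))
                   (βgo-swaps c d rest)
... | false = swaps-refl (c ∷ d ∷ rest)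

β-swaps : ∀ x w → NonConsecutiveSwaps w (β x w)
β-swaps x []       = []
β-swaps x (a ∷ []) = keep []
β-swaps x (a ∷ b ∷ rest) with between a x b in eq
... | true  = swap (between⇒nonConsecutive a x b eq) (βgo-swaps a b rest)
... | false = swaps-refl (a ∷ b ∷ rest)

proposition5p1 : (u v y : List ℕ) (x : ℕ) →
    IsPermutation (u ++ x ∷ v ++ y) →
    (i : ℕ) → (i ∈iDes (u ++ x ∷ v ++ y)) ⇔ (i ∈iDes (u ++ x ∷ β x v ++ y))
proposition5p1 u v y x _ i = mk⇔ (swaps-preserve-iDes s) (swaps-preserve-iDes (swaps-sym s))
  where
  s : NonConsecutiveSwaps (u ++ x ∷ v ++ y) (u ++ x ∷ β x v ++ y)
  s = swaps-++ˡ u (keep (swaps-++ʳ y (β-swaps x v)))
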